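{- There exists a stochastic graph $G$ with a single online vertex $v$ such that $\mathrm{OPT}(G)=0.856269\cdot\mathrm{OPT}_{\mathrm{non}}(G)$, where the constant is rounded to six decimal places.
   Context: A stochastic graph is a bipartite graph $G=(U,V,E)$ ($U$ offline, $V$ online) with edge weights $w_e\ge0$ and probabilities $p_e$; each edge is independently active with probability $p_e$. Each $v\in V$ has a substring-closed set $\mathcal{C}_v$ of strings of distinct edges at $v$ specifying allowed probe sequences (e.g. patience $\ell_v$: any at most $\ell_v$ distinct edges in any order). $\mathrm{OPT}(G)$ (committal benchmark): the maximum expected weight of the matching built by an algorithm that knows $G$ but not the states, adaptively probes edges (the probed sequence at each $v$ always in $\mathcal{C}_v$), and respects commitment (a probed active edge with both endpoints unmatched is immediately added to the matching). $\mathrm{OPT}_{\mathrm{non}}(G)$ (non-committal benchmark): the maximum expected weight achieved by an algorithm which adaptively probes edges subject to the same constraints but, after all probes, returns a maximum-weight matching among the probed active edges. -}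

module Defs where

open import Data.Nat using (ℕ)
open import Data.Fin using (Fin)
open import Data.List using (List; []; _∷_; _++_; [_])
open import Data.List.Relation.Unary.Unique.Propositional using (Unique)
open import Data.List.Relation.Binary.Sublist.Propositional using (_⊆_)
open import Data.Integer using (+_)
open import Data.Rational using (ℚ; 0ℚ; 1ℚ; _+_; _*_; _-_; _≤_; _<_; _⊔_; _/_)
open import Data.Product using (Σ; _×_; _,_; ∃)
open import Data.Unit using (⊤)
open import Relation.Binary.PropositionalEquality using (_≡_)

-- A stochastic graph with a single online vertex v and offline vertices Fin n;
-- the edge (u , v) is identified with u : Fin n.
record StochGraph1 : Set₁ where
  field
    n      : ℕ
    w      : Fin n → ℚ
    p      : Fin n → ℚ
    C      : List (Fin n) → Set        -- allowed probe strings at v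
    w≥0    : ∀ e → 0ℚ ≤ w e
    p≥0    : ∀ e → 0ℚ ≤ p e
    p≤1    : ∀ e → p e ≤ 1ℚ
    C-distinct : ∀ s → C s → Unique s
    C-closed   : ∀ s t → t ⊆ s → C s → C t

-- Adaptive probing strategies (decision trees): probe an edge, then continue
-- depending on whether it was active (first branch) or inactive (second).
data Strategy (n : ℕ) : Set where
  stop  : Strategy n
  probe : Fin n → Strategy n → Strategy n → Strategy n

module _ (G : StochGraph1) where
  open StochGraph1 G

  ValidFrom : List (Fin n) → Strategy n → Set
  ValidFrom s stop          = ⊤
  ValidFrom s (probe e a b) =
    C (s ++ [ e ]) × ValidFrom (s ++ [ e ]) a × ValidFrom (s ++ [ e ]) b

  Valid : Strategy n → Set
  Valid = ValidFrom []

  -- Committal: the first active probed edge is matched to v; afterwards v is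
  -- matched and nothing more can be gained.
  valCommit : Strategy n → ℚ
  valCommit stop          = 0ℚ
  valCommit (probe e a b) = p e * w e + (1ℚ - p e) * valCommit b

  -- Non-committal: at the end, return a maximum-weight matching among probed
  -- active edges, i.e. the heaviest probed active edge (cur = best so far).
  valNon : ℚ → Strategy n → ℚ
  valNon cur stop          = cur
  valNon cur (probe e a b) = p e * valNon (cur ⊔ w e) a + (1ℚ - p e) * valNon cur b

  IsOptimal : (Strategy n → ℚ) → ℚ → Set
  IsOptimal val x = (∃ λ t → Valid t × val t ≡ x) × (∀ t → Valid t → val t ≤ x)

  IsOPT : ℚ → Set
  IsOPT = IsOptimal valCommit

  IsOPTnon : ℚ → Set
  IsOPTnon = IsOptimal (valNon 0ℚ)

-- "a = c · b with c rounded to six decimals equal to 0.856269":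
-- 0.8562685 · b ≤ a < 0.8562695 · b
RatioRoundsTo856269 : ℚ → ℚ → Set
RatioRoundsTo856269 a b =
  ((+ 8562685 / 10000000) * b ≤ a) × (a < (+ 8562695 / 10000000) * b)

-- A single online vertex v with two offline neighbours, edges e₁ and e₂,
-- each active with probability 1/2, of weights 1 and w₂ = 32103/20000.  The
-- only probe strings allowed at v are [], [e₁], [e₂] and [e₁ e₂]: edge e₂ may
-- be probed after e₁ but never before it.
--
-- A committal algorithm must accept e₁ whenever it is active, so its best
-- value is 1/2 + w₂/4; a non-committal one probes both edges and keeps the
-- heavier active one, getting w₂/2 + 1/4.  The ratio of these two values is
-- 0.856269 up to rounding.
module Submission where

open import Defs
open import Data.Rational using (ℚ; 0ℚ; 1ℚ; _/_; _≤_; _<_; _≤?_; _<?_)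
open import Data.Integer using (+_)
open import Data.Product using (Σ; _×_; _,_)
open import Data.Fin using (Fin; zero; suc)
open import Data.List using (List; []; _∷_; _++_; [_])
open import Data.List.Membership.Propositional using (_∈_)
open import Data.List.Relation.Unary.Any using (here; there)
open import Data.List.Relation.Unary.All as All using (All)
open import Data.List.Relation.Unary.AllPairs using ([]; _∷_)
open import Data.List.Relation.Unary.Unique.Propositional using (Unique)
open import Data.List.Relation.Binary.Sublist.Propositional using (_⊆_; []; _∷_; _∷ʳ_)
open import Relation.Nullary using (¬_)
open import Relation.Nullary.Decidable using (True; toWitness)
open import Relation.Binary.PropositionalEquality using (_≡_; refl)
open import Data.Unit using (tt)
open import Data.Empty using (⊥-elim)

≤-byEvaluation : (x y : ℚ) → {True (x ≤? y)} → x ≤ y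
≤-byEvaluation x y {x≤y} = toWitness x≤y

<-byEvaluation : (x y : ℚ) → {True (x <? y)} → x < y
<-byEvaluation x y {x<y} = toWitness x<y

module _ (G : StochGraph1) where
  open StochGraph1 G

  maximal⇒stop : ∀ {s t} → (∀ e → ¬ C (s ++ [ e ])) → ValidFrom G s t → t ≡ stop
  maximal⇒stop {t = stop}        _           _            = refl
  maximal⇒stop {t = probe e _ _} noExtension (s++e∈C , _) = ⊥-elim (noExtension e s++e∈C)

  boundedOnEnumeration : (val : Strategy n → ℚ) (x : ℚ) (L : List (Strategy n)) →
                         (∀ {t} → Valid G t → t ∈ L) → All (λ t → val t ≤ x) L →
                         ∀ t → Valid G t → val t ≤ x
  boundedOnEnumeration val x L exhaustive bounded t valid =
    All.lookup bounded (exhaustive valid)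

e₁ e₂ : Fin 2
e₁ = zero
e₂ = suc zero

data Allowed : List (Fin 2) → Set where
  none   : Allowed []
  only₁  : Allowed [ e₁ ]
  only₂  : Allowed [ e₂ ]
  first₁ : Allowed (e₁ ∷ e₂ ∷ [])

allowed-distinct : ∀ s → Allowed s → Unique s
allowed-distinct _ none   = []
allowed-distinct _ only₁  = All.[] ∷ []
allowed-distinct _ only₂  = All.[] ∷ []
allowed-distinct _ first₁ = ((λ ()) All.∷ All.[]) ∷ All.[] ∷ []

allowed-closed : ∀ s t → t ⊆ s → Allowed s → Allowed t
allowed-closed _ _ []                    none   = none
allowed-closed _ _ (_ ∷ʳ [])             only₁  = none
allowed-closed _ _ (refl ∷ [])           only₁  = only₁
allowed-closed _ _ (_ ∷ʳ [])             only₂  = none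
allowed-closed _ _ (refl ∷ [])           only₂  = only₂
allowed-closed _ _ (_ ∷ʳ (_ ∷ʳ []))      first₁ = none
allowed-closed _ _ (_ ∷ʳ (refl ∷ []))    first₁ = only₂
allowed-closed _ _ (refl ∷ (_ ∷ʳ []))    first₁ = only₁
allowed-closed _ _ (refl ∷ (refl ∷ []))  first₁ = first₁

weight : Fin 2 → ℚ
weight zero       = 1ℚ
weight (suc zero) = + 32103 / 20000

probability : Fin 2 → ℚ
probability _ = + 1 / 2

example : StochGraph1
example = record
  { n = 2 ; w = weight ; p = probability ; C = Allowed
  ; w≥0 = λ { zero → ≤-byEvaluation _ _ ; (suc zero) → ≤-byEvaluation _ _ }
  ; p≥0 = λ _ → ≤-byEvaluation _ _
  ; p≤1 = λ _ → ≤-byEvaluation _ _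
  ; C-distinct = allowed-distinct
  ; C-closed = allowed-closed }

probe₂ : Strategy 2
probe₂ = probe e₂ stop stop

afterFirst : List (Strategy 2)
afterFirst = stop ∷ probe₂ ∷ []

validStrategies : List (Strategy 2)
validStrategies =
  stop ∷ probe₂ ∷
  probe e₁ stop stop ∷ probe e₁ stop probe₂ ∷
  probe e₁ probe₂ stop ∷ probe e₁ probe₂ probe₂ ∷ []

maximal-[e₂] : ∀ e → ¬ Allowed ([ e₂ ] ++ [ e ])
maximal-[e₂] _ ()

maximal-[e₁e₂] : ∀ e → ¬ Allowed ((e₁ ∷ e₂ ∷ []) ++ [ e ])
maximal-[e₁e₂] _ ()

validAfterFirst : ∀ {t} → ValidFrom example [ e₁ ] t → t ∈ afterFirst
validAfterFirst {stop} _ = here refl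
validAfterFirst {probe zero _ _} (() , _)
validAfterFirst {probe (suc zero) a b} (_ , va , vb)
  with maximal⇒stop example maximal-[e₁e₂] va | maximal⇒stop example maximal-[e₁e₂] vb
... | refl | refl = there (here refl)

validStrategies-exhaustive : ∀ {t} → Valid example t → t ∈ validStrategies
validStrategies-exhaustive {stop} _ = here refl
validStrategies-exhaustive {probe (suc zero) a b} (_ , va , vb)
  with maximal⇒stop example maximal-[e₂] va | maximal⇒stop example maximal-[e₂] vb
... | refl | refl = there (here refl)
validStrategies-exhaustive {probe zero a b} (_ , va , vb)
  with validAfterFirst va | validAfterFirst vb
... | here refl         | here refl         = there (there (here refl))
... | here refl         | there (here refl) = there (there (there (here refl)))
... | there (here refl) | here refl         = there (there (there (there (here refl))))
... | there (here refl) | there (here refl) = there (there (there (there (there (here refl)))))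

optimalByEnumeration : (val : Strategy 2 → ℚ) (x : ℚ) (t : Strategy 2) →
                       Valid example t → val t ≡ x →
                       {True (All.all? (λ t → val t ≤? x) validStrategies)} →
                       IsOptimal example val x
optimalByEnumeration val x t valid attains {bounded} =
  (t , valid , attains) ,
  boundedOnEnumeration example val x validStrategies
    validStrategies-exhaustive (toWitness bounded)

-- Committal optimum: probe e₁, and only if it is inactive probe e₂;
-- value 1/2 + w₂/4.
committalOptimum : ℚ
committalOptimum = + 72103 / 80000

committalOPT : IsOPT example committalOptimum
committalOPT =
  optimalByEnumeration (valCommit example) committalOptimum
    (probe e₁ stop probe₂) (only₁ , tt , first₁ , tt , tt) refl

-- Non-committal optimum: probe both edges and keep the heavier active one;
-- value w₂/2 + 1/4.
nonCommittalOptimum : ℚ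
nonCommittalOptimum = + 42103 / 40000

nonCommittalOPT : IsOPTnon example nonCommittalOptimum
nonCommittalOPT =
  optimalByEnumeration (valNon example 0ℚ) nonCommittalOptimum
    (probe e₁ probe₂ probe₂) (only₁ , (first₁ , tt , tt) , (first₁ , tt , tt)) refl

-- The ratio 72103/84206 = 0.85626915… rounds to 0.856269.
propositionA1 : Σ StochGraph1 λ G → Σ ℚ λ a → Σ ℚ λ b → IsOPT G a × IsOPTnon G b × RatioRoundsTo856269 a b
propositionA1 =
  example , committalOptimum , nonCommittalOptimum ,
  committalOPT , nonCommittalOPT ,
  ≤-byEvaluation _ _ , <-byEvaluation _ _
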